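{- The graph $K_{3,3}-e$ (the complete bipartite graph $K_{3,3}$ with one edge removed) is not the graph of stably matchable pairs of any stable matching instance.
   Context: A stable matching instance consists of finite disjoint sets of students and residencies, where each student has a strict linear preference order on a subset of the residencies and each residency has a strict linear preference order on a subset of the students. A matching (set of student–residency pairs, each element in at most one pair) is stable if each of its pairs is mutually acceptable (each member appears in the other's list) and no mutually acceptable pair $(s,r)$ not in it has both $s$ unmatched or preferring $r$ to its partner and $r$ unmatched or preferring $s$ to its partner. The graph of stably matchable pairs of the instance is the bipartite graph whose vertices are all students and residencies and whose edges are the pairs occurring in at least one stable matching; "is the graph of stably matchable pairs" is meant up to graph isomorphism. -}

module Defs where

open import Level using (Level; _⊔_)
open import Data.Nat using (ℕ)
open import Data.Fin using (Fin; zero; suc)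
open import Data.List using (List; _∷_)
open import Data.List.Membership.Propositional using (_∈_)
open import Data.List.Relation.Unary.Unique.Propositional using (Unique)
open import Data.Sum using (_⊎_; inj₁; inj₂)
open import Data.Product using (Σ; ∃; _×_; _,_)
open import Data.Empty using (⊥)
open import Data.Unit using (⊤)
open import Relation.Nullary using (¬_)
open import Relation.Binary.PropositionalEquality using (_≡_)
open import Function.Bundles using (_↔_; _⇔_; Inverse)

-- a strictly precedes b in the list (a list without repetitions encodes a
-- strict linear order on the subset of its elements; earlier = more preferred)
data Before {A : Set} (a b : A) : List A → Set where
  here  : ∀ {L} → b ∈ L → Before a b (a ∷ L)
  there : ∀ {c L} → Before a b L → Before a b (c ∷ L)

record Instance (m n : ℕ) : Set where
  field
    prefS   : Fin m → List (Fin n)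
    prefR   : Fin n → List (Fin m)
    uniqueS : ∀ s → Unique (prefS s)
    uniqueR : ∀ r → Unique (prefR r)

record Matching (m n : ℕ) : Set₁ where
  field
    _~_    : Fin m → Fin n → Set
    funS   : ∀ {s r r'} → s ~ r → s ~ r' → r ≡ r'
    funR   : ∀ {s s' r} → s ~ r → s' ~ r → s ≡ s'

module _ {m n : ℕ} (I : Instance m n) where
  open Instance I

  Acceptable : Fin m → Fin n → Set
  Acceptable s r = (r ∈ prefS s) × (s ∈ prefR r)

  IsStable : Matching m n → Set
  IsStable M =
      (∀ s r → s ~ r → Acceptable s r)
    × (∀ s r → Acceptable s r → ¬ (s ~ r) →
         ¬ ( ((∀ r' → ¬ (s ~ r')) ⊎ (Σ (Fin n) λ r' → (s ~ r') × Before r r' (prefS s)))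
           × ((∀ s' → ¬ (s' ~ r)) ⊎ (Σ (Fin m) λ s' → (s' ~ r) × Before s s' (prefR r)))))
    where open Matching M

  StablyMatchable : Fin m → Fin n → Set₁
  StablyMatchable s r = Σ (Matching m n) λ M → IsStable M × Matching._~_ M s r

  SMPEdge : Fin m ⊎ Fin n → Fin m ⊎ Fin n → Set₁
  SMPEdge (inj₁ s) (inj₂ r) = StablyMatchable s r
  SMPEdge (inj₂ r) (inj₁ s) = StablyMatchable s r
  SMPEdge _        _        = Level.Lift _ ⊥

K33-e-Edge : Fin 3 ⊎ Fin 3 → Fin 3 ⊎ Fin 3 → Set
K33-e-Edge (inj₁ zero) (inj₂ zero) = ⊥
K33-e-Edge (inj₂ zero) (inj₁ zero) = ⊥
K33-e-Edge (inj₁ _)    (inj₂ _)    = ⊤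
K33-e-Edge (inj₂ _)    (inj₁ _)    = ⊤
K33-e-Edge _           _           = ⊥

record GraphIso {ℓ₁ ℓ₂ : Level} (V₁ V₂ : Set) (E₁ : V₁ → V₁ → Set ℓ₁) (E₂ : V₂ → V₂ → Set ℓ₂)
       : Set (ℓ₁ ⊔ ℓ₂) where
  field
    bij : V₁ ↔ V₂
  open Inverse bij using (to)
  field
    adj : ∀ x y → E₁ x y ⇔ E₂ (to x) (to y)

-- Suppose the graph of stably matchable pairs is K₃,₃ − e, the missing edge joining
-- student s₀ to residency r₀ (after exchanging the roles of students and residencies
-- if necessary).  By the rural hospitals theorem every stable matching matches s₀, s₁
-- and s₂, so a stable matching containing a pair sᵢrⱼ with i, j ∈ {1, 2} must be the
-- perfect matching of K₃,₃ − e through that pair.  If s₀ prefers r₁ to r₂, comparing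
-- these four matchings through the opposing interests of students and residencies in
-- stable matchings shows that s₁ and s₂ both prefer r₀ to r₁, and then r₀ would have
-- to prefer each of s₁ and s₂ to the other.

module Submission where

open import Defs
open import Data.Nat using (ℕ; zero; suc; _≤_; z≤n; _≟_)
open import Data.Nat.Properties using (≤∧≢⇒<; m<1+n⇒m≤n; n<1+n; <-irrefl)
open import Data.Fin using (Fin; toℕ)
open import Data.Fin.Patterns using (0F; 1F; 2F)
open import Data.Fin.Properties using (pigeonhole; toℕ≤pred[n])
open import Data.List.Membership.Propositional using (_∈_)
open import Data.List.Relation.Unary.Any using (here; there)
import Data.List.Relation.Unary.All as All
open import Data.List.Relation.Unary.AllPairs using (_∷_)
open import Data.List.Relation.Unary.Unique.Propositional using (Unique)
open import Data.Sum using (_⊎_; inj₁; inj₂; swap; map; [_,_]′)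
open import Data.Sum.Properties using (inj₁-injective; inj₂-injective; swap-↔)
open import Data.Product using (Σ; ∃; ∃₂; _×_; _,_; proj₁; proj₂)
import Data.Product as Product
open import Data.Empty using (⊥-elim)
open import Data.Unit using (tt)
open import Relation.Nullary using (¬_; yes; no; contradiction)
open import Relation.Binary.PropositionalEquality
open import Function.Bundles using (Inverse; Equivalence; _⇔_; mk⇔)
open import Function.Construct.Composition using (_↔-∘_; _⇔-∘_)
open import Function.Definitions using (Injective)
open import Function.Base using (_∘_; id)

module _ {A : Set} where

  Before⇒∈ : ∀ {a b : A} {L} → Before a b L → b ∈ L
  Before⇒∈ (here b∈L) = there b∈L
  Before⇒∈ (there p)  = there (Before⇒∈ p)

  Before-irrefl : ∀ {a : A} {L} → Unique L → ¬ Before a a L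
  Before-irrefl (a∉L ∷ _) (here a∈L) = All.lookup a∉L a∈L refl
  Before-irrefl (_ ∷ u)   (there p)  = Before-irrefl u p

  Before-asym : ∀ {a b : A} {L} → Unique L → Before a b L → ¬ Before b a L
  Before-asym (a∉L ∷ _) (here b∈L) (here a∈L) = All.lookup a∉L a∈L refl
  Before-asym (a∉L ∷ _) (here _)   (there q)  = All.lookup a∉L (Before⇒∈ q) refl
  Before-asym (b∉L ∷ _) (there p)  (here _)   = All.lookup b∉L (Before⇒∈ p) refl
  Before-asym (_ ∷ u)   (there p)  (there q)  = Before-asym u p q

  Before-total : ∀ {a b : A} {L} → a ∈ L → b ∈ L → a ≢ b → Before a b L ⊎ Before b a L
  Before-total (here refl) (here refl) a≢b = contradiction refl a≢b
  Before-total (here refl) (there b∈L) _   = inj₁ (here b∈L)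
  Before-total (there a∈L) (here refl) _   = inj₂ (here a∈L)
  Before-total (there a∈L) (there b∈L) a≢b = map there there (Before-total a∈L b∈L a≢b)

record StableMatching {m n : ℕ} (I : Instance m n) : Set₁ where
  field
    matching : Matching m n
    stable   : IsStable I matching

open StableMatching

infix 4 _⊢_~_
_⊢_~_ : ∀ {m n} {I : Instance m n} → StableMatching I → Fin m → Fin n → Set
M ⊢ s ~ r = Matching._~_ (matching M) s r

module _ {m n : ℕ} {I : Instance m n} (M : StableMatching I) where
  open Instance I

  Unmatchedˢ : Fin m → Set
  Unmatchedˢ s = ∀ r → ¬ (M ⊢ s ~ r)

  Unmatchedʳ : Fin n → Set
  Unmatchedʳ r = ∀ s → ¬ (M ⊢ s ~ r)

  Desiresˢ : Fin m → Fin n → Set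
  Desiresˢ s r = Unmatchedˢ s ⊎ Σ (Fin n) λ r' → M ⊢ s ~ r' × Before r r' (prefS s)

  Desiresʳ : Fin n → Fin m → Set
  Desiresʳ r s = Unmatchedʳ r ⊎ Σ (Fin m) λ s' → M ⊢ s' ~ r × Before s s' (prefR r)

  matched⇒acceptable : ∀ {s r} → M ⊢ s ~ r → Acceptable I s r
  matched⇒acceptable = proj₁ (stable M) _ _

  desired⇒unmatched : ∀ {s r} → Desiresˢ s r → ¬ (M ⊢ s ~ r)
  desired⇒unmatched (inj₁ unmatched) s~r = unmatched _ s~r
  desired⇒unmatched {s} (inj₂ (_ , s~r' , r≺r')) s~r
    with Matching.funS (matching M) s~r s~r'
  ... | refl = Before-irrefl (uniqueS s) r≺r'

  desired⇒matchedʳ : ∀ {s r} → Acceptable I s r → Desiresˢ s r → ¬ Unmatchedʳ r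
  desired⇒matchedʳ acc d unmatched =
    proj₂ (stable M) _ _ acc (desired⇒unmatched d) (d , inj₁ unmatched)

  partnerBeats : ∀ {s r t} → Acceptable I s r → Desiresˢ s r → M ⊢ t ~ r →
                 Before t s (prefR r)
  partnerBeats {s} {r} {t} acc d t~r
    with Before-total (proj₂ (matched⇒acceptable t~r)) (proj₂ acc)
                      (λ { refl → desired⇒unmatched d t~r })
  ... | inj₁ t≺s = t≺s
  ... | inj₂ s≺t = ⊥-elim (proj₂ (stable M) s r acc (desired⇒unmatched d) (d , inj₂ (t , t~r , s≺t)))

transpose : ∀ {m n} → Instance m n → Instance n m
transpose I = record
  { prefS = prefR ; prefR = prefS ; uniqueS = uniqueR ; uniqueR = uniqueS }
  where open Instance I

transposeMatching : ∀ {m n} {I : Instance m n} → StableMatching I → StableMatching (transpose I)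
transposeMatching M = record
  { matching = record { _~_ = λ r s → M ⊢ s ~ r ; funS = funR ; funR = funS }
  ; stable   = (λ r s r~s → Product.swap (proj₁ (stable M) s r r~s))
             , (λ r s acc ¬r~s blocking →
                  proj₂ (stable M) s r (Product.swap acc) ¬r~s (Product.swap blocking))
  }
  where open Matching (matching M)

transpose-StablyMatchable : ∀ {m n} {I : Instance m n} {s r} →
                            StablyMatchable I s r → StablyMatchable (transpose I) r s
transpose-StablyMatchable {I = I} (M , st , s~r) = matching Mᵀ , stable Mᵀ , s~r
  where
    Mᵀ : StableMatching (transpose I)
    Mᵀ = transposeMatching record { matching = M ; stable = st }

module _ {m n : ℕ} {I : Instance m n} (M : StableMatching I) where
  open Instance I

  desired⇒matchedˢ : ∀ {s r} → Acceptable I s r → Desiresʳ M r s → ¬ Unmatchedˢ M s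
  desired⇒matchedˢ acc = desired⇒matchedʳ (transposeMatching M) (Product.swap acc)

  partnerBeatsʳ : ∀ {s r r'} → Acceptable I s r → Desiresʳ M r s → M ⊢ s ~ r' →
                  Before r' r (prefS s)
  partnerBeatsʳ acc = partnerBeats (transposeMatching M) (Product.swap acc)

module _ {m n : ℕ} {I : Instance m n} (M M' : StableMatching I) where
  open Instance I

  -- s prefers M to M', hence r = M(s) prefers M' to M, hence t = M'(r) prefers M to M'.
  preferenceTransfer : ∀ {s t r r' q} →
    M ⊢ s ~ r → M ⊢ t ~ q → M' ⊢ s ~ r' → M' ⊢ t ~ r →
    Before r r' (prefS s) → Before q r (prefS t)
  preferenceTransfer s~r t~q s~r' t~r r≺r' =
    partnerBeatsʳ M (matched⇒acceptable M' t~r)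
      (inj₂ (_ , s~r , partnerBeats M' (matched⇒acceptable M s~r) (inj₂ (_ , s~r' , r≺r')) t~r))
      t~q

  noCommonFavourite : ∀ {s t r r'} →
    M ⊢ s ~ r → M ⊢ t ~ r' → M' ⊢ s ~ r' → M' ⊢ t ~ r →
    Before r r' (prefS s) → ¬ Before r r' (prefS t)
  noCommonFavourite {r = r} s~r t~r' s~r' t~r r≺ₛr' r≺ₜr' =
    Before-asym (uniqueR r)
      (partnerBeats M' (matched⇒acceptable M s~r) (inj₂ (_ , s~r' , r≺ₛr')) t~r)
      (partnerBeats M (matched⇒acceptable M' t~r) (inj₂ (_ , t~r' , r≺ₜr')) s~r)

  alternatingStep : ∀ {s r} → M' ⊢ s ~ r → Desiresˢ M s r →
    ¬ ¬ (∃₂ λ s₁ r₂ → M ⊢ s₁ ~ r × M' ⊢ s₁ ~ r₂ × Desiresˢ M s₁ r₂)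
  alternatingStep {s} {r} s~'r d k =
    desired⇒matchedʳ M (matched⇒acceptable M' s~'r) d λ s₁ s₁~r →
      let acc₁     = matched⇒acceptable M s₁~r
          desired' = inj₂ (s , s~'r , partnerBeats M (matched⇒acceptable M' s~'r) d s₁~r)
      in desired⇒matchedˢ M' acc₁ desired' λ r₂ s₁~'r₂ →
           k (s₁ , r₂ , s₁~r , s₁~'r₂ , inj₂ (r , s₁~r , partnerBeatsʳ M' acc₁ desired' s₁~'r₂))

-- Passing from a student to its M'-partner and on to that residency's M-partner,
-- starting at an M-unmatched student s₀, gives a chain that alternatingStep can
-- always extend; yet it never revisits a student, because s₀ has no M-partner.
module AlternatingChain {m n : ℕ} {I : Instance m n} (M M' : StableMatching I)
                        {s₀ : Fin m} (s₀-unmatched : Unmatchedˢ M s₀) where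

  data Chain : ℕ → Fin m → Set where
    start  : Chain 0 s₀
    extend : ∀ {k s r s₁} → Chain k s → M' ⊢ s ~ r → M ⊢ s₁ ~ r → Chain (suc k) s₁

  Chain-depth-unique : ∀ {i j s} → Chain i s → Chain j s → i ≡ j
  Chain-depth-unique start            start              = refl
  Chain-depth-unique start            (extend _ _ s₀~r)  = contradiction s₀~r (s₀-unmatched _)
  Chain-depth-unique (extend _ _ s₀~r) start             = contradiction s₀~r (s₀-unmatched _)
  Chain-depth-unique (extend c s~'r s₁~r) (extend d t~'q s₁~q)
    with Matching.funS (matching M) s₁~r s₁~q
  ... | refl with Matching.funR (matching M') s~'r t~'q
  ... | refl = cong suc (Chain-depth-unique c d)

  prefix : ∀ {k s} → Chain k s → ∀ {i} → i ≤ k → ∃ (Chain i)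
  prefix {k} {s} c {i} i≤k with i ≟ k
  ... | yes refl = s , c
  prefix start         z≤n | no i≢0 = contradiction refl i≢0
  prefix (extend c _ _) i≤k | no i≢k = prefix c (m<1+n⇒m≤n (≤∧≢⇒< i≤k i≢k))

  ¬Chain-m : ∀ {s} → ¬ Chain m s
  ¬Chain-m c with pigeonhole (n<1+n m) (λ i → proj₁ (prefix c (toℕ≤pred[n] i)))
  ... | i , j , i<j , same =
    <-irrefl (Chain-depth-unique (proj₂ (prefix c (toℕ≤pred[n] i)))
                                 (subst (Chain (toℕ j)) (sym same) (proj₂ (prefix c (toℕ≤pred[n] j)))))
             i<j

  chainOfLength : ∀ {r₀} → M' ⊢ s₀ ~ r₀ → ∀ k →
          ¬ ¬ (∃₂ λ s r → Chain k s × M' ⊢ s ~ r × Desiresˢ M s r)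
  chainOfLength {r₀} s₀~'r₀ zero k = k (s₀ , r₀ , start , s₀~'r₀ , inj₁ s₀-unmatched)
  chainOfLength s₀~'r₀ (suc j) k = chainOfLength s₀~'r₀ j λ (_ , _ , c , s~'r , d) →
    alternatingStep M M' s~'r d λ (s₁ , r₂ , s₁~r , s₁~'r₂ , d₁) →
      k (s₁ , r₂ , extend c s~'r s₁~r , s₁~'r₂ , d₁)

ruralHospitals : ∀ {m n} {I : Instance m n} (M M' : StableMatching I) {s r} →
                 M' ⊢ s ~ r → ¬ Unmatchedˢ M s
ruralHospitals {m} M M' s~'r unmatched =
  chainOfLength s~'r m λ (_ , _ , c , _) → ¬Chain-m c
  where open AlternatingChain M M' unmatched

stablyMatched : ∀ {m n} {I : Instance m n} {s r} →
                StablyMatchable I s r → Σ (StableMatching I) λ M → M ⊢ s ~ r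
stablyMatched (M , st , s~r) = record { matching = M ; stable = st } , s~r

StablyMatchable⇒Acceptable : ∀ {m n} (I : Instance m n) {s r} →
                             StablyMatchable I s r → Acceptable I s r
StablyMatchable⇒Acceptable _ (_ , stable , s~r) = proj₁ stable _ _ s~r

record K33-e-Embedding {m n : ℕ} (I : Instance m n) : Set₁ where
  field
    student             : Fin 3 → Fin m
    residency           : Fin 3 → Fin n
    student-injective   : Injective _≡_ _≡_ student
    residency-injective : Injective _≡_ _≡_ residency
    matchable           : ∀ {i j} → K33-e-Edge (inj₁ i) (inj₂ j) →
                          StablyMatchable I (student i) (residency j)
    matchable⇒edge      : ∀ {i r} → StablyMatchable I (student i) r →
                          ∃ λ j → K33-e-Edge (inj₁ i) (inj₂ j) × r ≡ residency j

K33-e-Edge-to-1F : ∀ i → K33-e-Edge (inj₁ i) (inj₂ 1F)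
K33-e-Edge-to-1F 0F = tt
K33-e-Edge-to-1F 1F = tt
K33-e-Edge-to-1F 2F = tt

K33-e-neighbour : ∀ i y → K33-e-Edge (inj₁ i) y → ∃ λ j → y ≡ inj₂ j × K33-e-Edge (inj₁ i) (inj₂ j)
K33-e-neighbour i (inj₂ j) e = j , refl , e
K33-e-neighbour 0F (inj₁ _) ()
K33-e-neighbour 1F (inj₁ _) ()
K33-e-neighbour 2F (inj₁ _) ()

swap₁₂ : Fin 3 → Fin 3
swap₁₂ 0F = 0F
swap₁₂ 1F = 2F
swap₁₂ 2F = 1F

swap₁₂-involutive : ∀ i → swap₁₂ (swap₁₂ i) ≡ i
swap₁₂-involutive 0F = refl
swap₁₂-involutive 1F = refl
swap₁₂-involutive 2F = refl

swap₁₂-injective : Injective _≡_ _≡_ swap₁₂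
swap₁₂-injective {i} {j} eq =
  trans (sym (swap₁₂-involutive i)) (trans (cong swap₁₂ eq) (swap₁₂-involutive j))

K33-e-Edge-swapˢ : ∀ {i j} → K33-e-Edge (inj₁ i) (inj₂ j) → K33-e-Edge (inj₁ (swap₁₂ i)) (inj₂ j)
K33-e-Edge-swapˢ {0F} e = e
K33-e-Edge-swapˢ {1F} e = tt
K33-e-Edge-swapˢ {2F} e = tt

K33-e-Edge-swapʳ : ∀ {i j} → K33-e-Edge (inj₁ i) (inj₂ j) → K33-e-Edge (inj₁ i) (inj₂ (swap₁₂ j))
K33-e-Edge-swapʳ {i} {0F} e = e
K33-e-Edge-swapʳ {0F} {1F} e = tt
K33-e-Edge-swapʳ {0F} {2F} e = tt
K33-e-Edge-swapʳ {1F} {1F} e = tt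
K33-e-Edge-swapʳ {1F} {2F} e = tt
K33-e-Edge-swapʳ {2F} {1F} e = tt
K33-e-Edge-swapʳ {2F} {2F} e = tt

module _ {m n : ℕ} {I : Instance m n} (E : K33-e-Embedding I) where
  open K33-e-Embedding E

  swapStudents : K33-e-Embedding I
  swapStudents = record
    { student             = student ∘ swap₁₂
    ; residency           = residency
    ; student-injective   = swap₁₂-injective ∘ student-injective
    ; residency-injective = residency-injective
    ; matchable           = matchable ∘ K33-e-Edge-swapˢ
    ; matchable⇒edge      = λ {i} sm → let (j , e , r≡) = matchable⇒edge sm in
        j , subst (λ i' → K33-e-Edge (inj₁ i') (inj₂ j)) (swap₁₂-involutive i) (K33-e-Edge-swapˢ e) , r≡
    }

  swapResidencies : K33-e-Embedding I
  swapResidencies = record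
    { student             = student
    ; residency           = residency ∘ swap₁₂
    ; student-injective   = student-injective
    ; residency-injective = swap₁₂-injective ∘ residency-injective
    ; matchable           = matchable ∘ K33-e-Edge-swapʳ
    ; matchable⇒edge      = λ sm → let (j , e , r≡) = matchable⇒edge sm in
        swap₁₂ j , K33-e-Edge-swapʳ e , trans r≡ (cong residency (sym (swap₁₂-involutive j)))
    }

module _ {m n : ℕ} {I : Instance m n} (E : K33-e-Embedding I) where
  open K33-e-Embedding E

  partnerAmongNeighbours : (M : StableMatching I) → ∀ i →
    ¬ ¬ (∃ λ j → K33-e-Edge (inj₁ i) (inj₂ j) × M ⊢ student i ~ residency j)
  partnerAmongNeighbours M i k =
    let (M' , s~'r₁) = stablyMatched (matchable (K33-e-Edge-to-1F i)) in
    ruralHospitals M M' s~'r₁ λ r s~r →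
      let (j , e , r≡) = matchable⇒edge (matching M , stable M , s~r) in
      k (j , e , subst (M ⊢ student i ~_) r≡ s~r)

  sharedResidency : ∀ (M : StableMatching I) {i i' j} →
    M ⊢ student i ~ residency j → M ⊢ student i' ~ residency j → i ≡ i'
  sharedResidency M sᵢ~r sᵢ'~r = student-injective (Matching.funR (matching M) sᵢ~r sᵢ'~r)

  completesCorner : (M : StableMatching I) → M ⊢ student 2F ~ residency 2F →
    ¬ ¬ (M ⊢ student 0F ~ residency 1F × M ⊢ student 1F ~ residency 0F)
  completesCorner M s₂~r₂ k = partnerAmongNeighbours M 0F λ where
    (0F , () , _)
    (1F , _ , s₀~r₁) → partnerAmongNeighbours M 1F λ where
      (0F , _ , s₁~r₀) → k (s₀~r₁ , s₁~r₀)
      (1F , _ , s₁~r₁) → contradiction (sharedResidency M s₁~r₁ s₀~r₁) λ ()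
      (2F , _ , s₁~r₂) → contradiction (sharedResidency M s₁~r₂ s₂~r₂) λ ()
    (2F , _ , s₀~r₂) → contradiction (sharedResidency M s₀~r₂ s₂~r₂) λ ()

  cornerMatching : ¬ ¬ (Σ (StableMatching I) λ M →
    M ⊢ student 2F ~ residency 2F × M ⊢ student 0F ~ residency 1F × M ⊢ student 1F ~ residency 0F)
  cornerMatching k =
    let (M , s₂~r₂) = stablyMatched (matchable tt) in
    completesCorner M s₂~r₂ λ (s₀~r₁ , s₁~r₀) → k (M , s₂~r₂ , s₀~r₁ , s₁~r₀)

module _ {m n : ℕ} {I : Instance m n} (E : K33-e-Embedding I) where
  open K33-e-Embedding E
  open Instance I

  -- Transferring the preference of student 0 from A to B and from C to D makes
  -- students 1 and 2 both prefer residency 0 to residency 1, which D and B forbid.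
  ¬prefers₁₂ : ¬ Before (residency 1F) (residency 2F) (prefS (student 0F))
  ¬prefers₁₂ r₁≺r₂ =
    cornerMatching E                                λ (A , _   , a₀₁ , a₁₀) →
    cornerMatching (swapStudents (swapResidencies E)) λ (B , b₁₁ , b₀₂ , b₂₀) →
    cornerMatching (swapStudents E)                 λ (C , _   , c₀₁ , c₂₀) →
    cornerMatching (swapResidencies E)              λ (D , d₂₁ , d₀₂ , d₁₀) →
    noCommonFavourite D B d₁₀ d₂₁ b₁₁ b₂₀
      (preferenceTransfer A B a₀₁ a₁₀ b₀₂ b₁₁ r₁≺r₂)
      (preferenceTransfer C D c₀₁ c₂₀ d₀₂ d₂₁ r₁≺r₂)

¬K33-e-Embedding : ∀ {m n} {I : Instance m n} → ¬ K33-e-Embedding I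
¬K33-e-Embedding {I = I} E =
  [ ¬prefers₁₂ E , ¬prefers₁₂ (swapResidencies E) ]′
    (Before-total (proj₁ (StablyMatchable⇒Acceptable I (matchable {0F} {1F} tt)))
                  (proj₁ (StablyMatchable⇒Acceptable I (matchable {0F} {2F} tt)))
                  (λ r₁≡r₂ → contradiction (residency-injective r₁≡r₂) λ ()))
  where open K33-e-Embedding E

transpose-SMPEdge : ∀ {m n} (I : Instance m n) x y →
                    SMPEdge (transpose I) x y ⇔ SMPEdge I (swap x) (swap y)
transpose-SMPEdge I (inj₁ _) (inj₂ _) =
  mk⇔ (transpose-StablyMatchable {I = transpose I}) (transpose-StablyMatchable {I = I})
transpose-SMPEdge I (inj₂ _) (inj₁ _) =
  mk⇔ (transpose-StablyMatchable {I = transpose I}) (transpose-StablyMatchable {I = I})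
transpose-SMPEdge I (inj₁ _) (inj₁ _) = mk⇔ id id
transpose-SMPEdge I (inj₂ _) (inj₂ _) = mk⇔ id id

transposeIso : ∀ {m n} {I : Instance m n} {V : Set} {ℓ} {E : V → V → Set ℓ} →
               GraphIso (Fin m ⊎ Fin n) V (SMPEdge I) E →
               GraphIso (Fin n ⊎ Fin m) V (SMPEdge (transpose I)) E
transposeIso {I = I} G = record
  { bij = bij ↔-∘ swap-↔
  ; adj = λ x y → adj (swap x) (swap y) ⇔-∘ transpose-SMPEdge I x y
  }
  where open GraphIso G

residencyNeighbour : ∀ {m n} {I : Instance m n} {s} x → SMPEdge I (inj₁ s) x → ∃ λ r → x ≡ inj₂ r
residencyNeighbour (inj₂ r) _ = r , refl

studentNeighbour : ∀ {m n} {I : Instance m n} {r} x → SMPEdge I x (inj₂ r) → ∃ λ s → x ≡ inj₁ s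
studentNeighbour (inj₁ s) _ = s , refl

module _ {m n : ℕ} {I : Instance m n}
         (G : GraphIso (Fin m ⊎ Fin n) (Fin 3 ⊎ Fin 3) (SMPEdge I) K33-e-Edge) where
  open GraphIso G
  open Inverse bij

  from-edge : ∀ a b → K33-e-Edge a b → SMPEdge I (from a) (from b)
  from-edge a b e = Equivalence.from (adj (from a) (from b))
    (subst₂ K33-e-Edge (sym (strictlyInverseˡ a)) (sym (strictlyInverseˡ b)) e)

  from-injective : Injective _≡_ _≡_ from
  from-injective {a} {b} eq = trans (sym (strictlyInverseˡ a)) (trans (cong to eq) (strictlyInverseˡ b))

  -- K₃,₃ − e is connected, so once one vertex lands among the students the
  -- whole bipartition is respected.
  module _ {s₀ : Fin m} (corner : from (inj₁ 0F) ≡ inj₁ s₀) where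

    residencyAt1F : ∃ λ r → from (inj₂ 1F) ≡ inj₂ r
    residencyAt1F = residencyNeighbour (from (inj₂ 1F))
      (subst (λ x → SMPEdge I x (from (inj₂ 1F))) corner (from-edge (inj₁ 0F) (inj₂ 1F) tt))

    studentAt : ∀ i → ∃ λ s → from (inj₁ i) ≡ inj₁ s
    studentAt i = studentNeighbour (from (inj₁ i))
      (subst (SMPEdge I (from (inj₁ i))) (proj₂ residencyAt1F) (from-edge (inj₁ i) (inj₂ 1F) (K33-e-Edge-to-1F i)))

    residencyAt : ∀ j → ∃ λ r → from (inj₂ j) ≡ inj₂ r
    residencyAt j = residencyNeighbour (from (inj₂ j))
      (subst (λ x → SMPEdge I x (from (inj₂ j))) (proj₂ (studentAt 1F)) (from-edge (inj₁ 1F) (inj₂ j) tt))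

    student : Fin 3 → Fin m
    student = proj₁ ∘ studentAt

    residency : Fin 3 → Fin n
    residency = proj₁ ∘ residencyAt

    to-student : ∀ i → to (inj₁ (student i)) ≡ inj₁ i
    to-student i = trans (cong to (sym (proj₂ (studentAt i)))) (strictlyInverseˡ (inj₁ i))

    matchable⇒edge : ∀ {i r} → StablyMatchable I (student i) r →
                     ∃ λ j → K33-e-Edge (inj₁ i) (inj₂ j) × r ≡ residency j
    matchable⇒edge {i} {r} sm =
      let (j , to-r≡ , e) = K33-e-neighbour i (to (inj₂ r))
            (subst (λ x → K33-e-Edge x (to (inj₂ r))) (to-student i)
                   (Equivalence.to (adj (inj₁ (student i)) (inj₂ r)) sm))
      in j , e , inj₂-injective (begin
           inj₂ r               ≡⟨ strictlyInverseʳ (inj₂ r) ⟨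
           from (to (inj₂ r))   ≡⟨ cong from to-r≡ ⟩
           from (inj₂ j)        ≡⟨ proj₂ (residencyAt j) ⟩
           inj₂ (residency j)   ∎)
      where open ≡-Reasoning

    embedding : K33-e-Embedding I
    embedding = record
      { student             = student
      ; residency           = residency
      ; student-injective   = λ {i} {i'} eq → inj₁-injective (from-injective
          (trans (proj₂ (studentAt i)) (trans (cong inj₁ eq) (sym (proj₂ (studentAt i'))))))
      ; residency-injective = λ {j} {j'} eq → inj₂-injective (from-injective
          (trans (proj₂ (residencyAt j)) (trans (cong inj₂ eq) (sym (proj₂ (residencyAt j'))))))
      ; matchable           = λ {i} {j} e → subst₂ (SMPEdge I) (proj₂ (studentAt i)) (proj₂ (residencyAt j))
                                                 (from-edge (inj₁ i) (inj₂ j) e)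
      ; matchable⇒edge      = matchable⇒edge
      }

mainTheorem3 : (m n : ℕ) (I : Instance m n) →
    ¬ GraphIso (Fin m ⊎ Fin n) (Fin 3 ⊎ Fin 3) (SMPEdge I) K33-e-Edge
mainTheorem3 m n I G with Inverse.from (GraphIso.bij G) (inj₁ 0F) in corner
... | inj₁ _ = ¬K33-e-Embedding (embedding G corner)
... | inj₂ _ = ¬K33-e-Embedding (embedding (transposeIso G) (cong swap corner))
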